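{- Let $n,k$ be positive integers with $n\geqslant k+2$, let $a_0,\ldots,a_k$ be non-zero integers each having all of its prime factors $\leqslant k$, and let $F_{n,k}(x)=\sum_{j=0}^k a_jc_jx^j$ where $c_j=(-1)^{k-j}\binom{n}{j}\binom{n-j-1}{k-j}$. Suppose there exist integers $l',l''$ with $1\leqslant l'<l''<k$ and $l'+l''\neq k$, and primes $p',p''>k$, such that $p'$ divides $n-l'$ exactly to the first power and $p''$ divides $n-l''$ exactly to the first power. Then $F_{n,k}(x)$ is irreducible over $\mathbb{Q}$. -}

module Defs where

open import Data.Nat as ℕ using (ℕ; zero; suc; _≤_; _<_; _∸_; _≤?_)
open import Data.Nat.Combinatorics using (_C_)
open import Data.Integer as ℤ using (ℤ; +_; -[1+_])
open import Data.Rational as ℚ using (ℚ; 0ℚ; _/_)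
open import Data.Product using (Σ; _×_)
open import Data.Sum using (_⊎_)
open import Relation.Binary.PropositionalEquality using (_≡_; _≢_)
open import Relation.Nullary using (yes; no)

-- Polynomials over ℚ are represented by coefficient functions ℕ → ℚ
-- (coefficient of x^m at index m); a genuine polynomial has a degree.

HasDegree : ℕ → (ℕ → ℚ) → Set
HasDegree d f = (f d ≢ 0ℚ) × (∀ m → d < m → f m ≡ 0ℚ)

convUpTo : (ℕ → ℚ) → (ℕ → ℚ) → ℕ → ℕ → ℚ
convUpTo f g m zero    = f 0 ℚ.* g m
convUpTo f g m (suc t) = convUpTo f g m t ℚ.+ (f (suc t) ℚ.* g (m ∸ suc t))

_·ₚ_ : (ℕ → ℚ) → (ℕ → ℚ) → (ℕ → ℚ)
(f ·ₚ g) m = convUpTo f g m m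

-- Irreducible over ℚ: non-constant (positive degree, so nonzero and not a unit),
-- and in every factorization f = g h in ℚ[x] one factor is a unit
-- (i.e. a nonzero constant, degree 0).
IrreducibleOverℚ : (ℕ → ℚ) → Set
IrreducibleOverℚ f =
  (Σ ℕ λ d → (1 ≤ d) × HasDegree d f) ×
  (∀ (g h : ℕ → ℚ) (d₁ d₂ : ℕ) → HasDegree d₁ g → HasDegree d₂ h →
     (∀ m → f m ≡ (g ·ₚ h) m) → (d₁ ≡ 0) ⊎ (d₂ ≡ 0))

c : ℕ → ℕ → ℕ → ℤ
c n k j = (-[1+ 0 ] ℤ.^ (k ∸ j)) ℤ.* (+ ((n C j) ℕ.* ((n ∸ j ∸ 1) C (k ∸ j))))

F : ℕ → ℕ → (ℕ → ℤ) → (ℕ → ℚ)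
F n k a j with j ≤? k
... | yes _ = ((a j) ℤ.* c n k j) / 1
... | no  _ = 0ℚ

-- Let p > k be a prime with p ∥ n − l and 1 ≤ l < k. Among n, n − 1, …, n − k only n − l is
-- divisible by p, and only once, while p divides neither a_j nor m! for m ≤ k. Since
-- c_j = ± n(n − 1)⋯(n − j + 1)/j! · (n − j − 1)⋯(n − k)/(k − j)!, the coefficient a_j c_j of F has
-- p-adic valuation 0 for j = l and 1 for all other j ≤ k.
-- For any factorisation F = g h over ℚ, the minimal valuation of the coefficients is additive, and
-- so are the first and the last index attaining it (the Newton polygon of g h is the sum of those of
-- g and h). Hence g and h each attain their minimum at a single index, these indices summing to l,
-- and comparing the constant and leading coefficients shows that g or h has degree 0 or l.
-- Using both primes, deg g ∈ {0, l′, k − l′, k} ∩ {0, l″, k − l″, k} = {0, k}, as l′ < l″ < k and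
-- l′ + l″ ≠ k.

module Submission where

open import Defs
open import Data.Nat as ℕ using (ℕ; zero; suc; _+_; _*_; _∸_; _^_; _!; _≤_; _<_; z≤n; s≤s; NonZero)
import Data.Nat.Properties as ℕP
open import Data.Nat.Divisibility using (_∣_; _∤_; divides; _∣?_; ∣-trans; *-cancelˡ-∣; ∣⇒≤; ∣m+n∣m⇒∣n; _∣0)
open import Data.Nat.Combinatorics using (_C_; nCk≡n!/k![n-k]!; k![n∸k]!∣n!; [n-k]*[n-k-1]!≡[n-k]!)
open import Data.Nat.Combinatorics.Base using (_P′_)
open import Data.Nat.DivMod using (_/_; m*[n/m]≡n)
open import Data.Nat.Induction using (<-rec)
open import Data.Nat.Primality using (Prime; euclidsLemma)
open import Data.Integer as ℤ using (ℤ; +_; -[1+_]; ∣_∣; 0ℤ; 1ℤ)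
import Data.Integer.Properties as ℤP
import Data.Integer.Divisibility.Signed as ℤD
open import Algebra.Properties.CommutativeSemigroup ℕP.*-commutativeSemigroup using (interchange)
open import Data.Integer.Tactic.RingSolver using (solve-∀)
open import Data.Rational as ℚ using (ℚ; 0ℚ; ↥_; ↧_)
import Data.Rational.Properties as ℚP
open import Data.Product using (Σ; _×_; _,_; proj₁; proj₂)
open import Data.Sum using (_⊎_; inj₁; inj₂; [_,_]′)
import Data.Sum as Sum
open import Data.Empty using (⊥-elim)
open import Relation.Binary.PropositionalEquality
open import Relation.Binary.Definitions using (tri<; tri≈; tri>)
open import Function using (_∘_)
open import Relation.Nullary using (¬_; yes; no; contradiction)

≤-+-≡⇒≡ : ∀ {a b c d} → a ≤ c → b ≤ d → a + b ≡ c + d → a ≡ c × b ≡ d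
≤-+-≡⇒≡ {a} {b} {c} {d} a≤c b≤d a+b≡c+d with ℕP.m≤n⇒m<n∨m≡n a≤c
... | inj₁ a<c  = contradiction a+b≡c+d (ℕP.<⇒≢ (ℕP.+-mono-<-≤ a<c b≤d))
... | inj₂ refl = refl , ℕP.+-cancelˡ-≡ a b d a+b≡c+d

module _ {a b M i : ℕ} where

  i<a⊎M∸i<b : i ≤ M → M < a + b ⊎ (M ≡ a + b × i ≢ a) → i < a ⊎ M ∸ i < b
  i<a⊎M∸i<b i≤M M≲a+b with ℕP.<-cmp i a
  ... | tri< i<a _ _ = inj₁ i<a
  ... | tri> _ _ a<i = inj₂ (ℕP.<-≤-trans (ℕP.∸-monoʳ-< a<i i≤M) (ℕP.m≤n+o⇒m∸n≤o M a M≤a+b))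
    where
    M≤a+b : M ≤ a + b
    M≤a+b = [ ℕP.<⇒≤ , ℕP.≤-reflexive ∘ proj₁ ]′ M≲a+b
  ... | tri≈ _ refl _ with M≲a+b
  ...   | inj₁ M<a+b    = inj₂ (subst (M ∸ a <_) (ℕP.m+n∸m≡n a b) (ℕP.∸-monoˡ-< M<a+b i≤M))
  ...   | inj₂ (_ , i≢a) = contradiction refl i≢a

  a<i⊎b<M∸i : a + b < M ⊎ (M ≡ a + b × i ≢ a) → a < i ⊎ b < M ∸ i
  a<i⊎b<M∸i a+b≲M with ℕP.<-cmp i a
  ... | tri> _ _ a<i = inj₁ a<i
  ... | tri< i<a _ _ = inj₂ (ℕP.≤-<-trans (ℕP.m+n≤o⇒m≤o∸n b (subst (_≤ M) (ℕP.+-comm a b) a+b≤M))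
                                          (ℕP.∸-monoʳ-< i<a (ℕP.m+n≤o⇒m≤o a a+b≤M)))
    where
    a+b≤M : a + b ≤ M
    a+b≤M = [ ℕP.<⇒≤ , ℕP.≤-reflexive ∘ sym ∘ proj₁ ]′ a+b≲M
  ... | tri≈ _ refl _ with a+b≲M
  ...   | inj₁ a+b<M    = inj₂ (subst (_< M ∸ a) (ℕP.m+n∸m≡n a b) (ℕP.∸-monoˡ-< a+b<M (ℕP.m≤m+n a b)))
  ...   | inj₂ (_ , i≢a) = contradiction refl i≢a

↥≢0 : ∀ {x} → x ≢ 0ℚ → ↥ x ≢ 0ℤ
↥≢0 {x} x≢0 ↥x≡0 = x≢0 (ℚP.↥p≡0⇒p≡0 x ↥x≡0)

↧≢0 : ∀ x → ↧ x ≢ 0ℤ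
↧≢0 x ()

*-≢0ℤ : ∀ {i j} → i ≢ 0ℤ → j ≢ 0ℤ → i ℤ.* j ≢ 0ℤ
*-≢0ℤ {i} i≢0 j≢0 ij≡0 = [ i≢0 , j≢0 ]′ (ℤP.i*j≡0⇒i≡0∨j≡0 i ij≡0)

≢0-factorʳ : ∀ {i j} → i ℤ.* j ≢ 0ℤ → j ≢ 0ℤ
≢0-factorʳ {i} ij≢0 refl = ij≢0 (ℤP.*-zeroʳ i)

≡0-scaled : ∀ {a X A} → a ℤ.* X ≡ A → a ≡ 0ℤ → A ≡ 0ℤ
≡0-scaled {X = X} refl refl = ℤP.*-zeroˡ X

≢0-numerator : ∀ {x X A} → ↥ x ℤ.* X ≡ A → A ≢ 0ℤ → x ≢ 0ℚ
≢0-numerator {x} ↥x*X≡A A≢0 x≡0 = A≢0 (≡0-scaled ↥x*X≡A (ℚP.p≡0⇒↥p≡0 x x≡0))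

*-≢0ℚ : ∀ {x y} → x ≢ 0ℚ → y ≢ 0ℚ → x ℚ.* y ≢ 0ℚ
*-≢0ℚ {x} {y} x≢0 y≢0 xy≡0 = *-≢0ℤ (↥≢0 x≢0) (↥≢0 y≢0)
  (≡0-scaled (ℚP.↥-* x y) (ℚP.p≡0⇒↥p≡0 _ xy≡0))

module Convolution (f g : ℕ → ℚ) (m : ℕ) where

  term : ℕ → ℚ
  term i = f i ℚ.* g (m ∸ i)

  convUpTo-all : ∀ (P : ℚ → Set) → (∀ {x y} → P x → P y → P (x ℚ.+ y)) →
                 ∀ t → (∀ i → i ≤ t → P (term i)) → P (convUpTo f g m t)
  convUpTo-all P P+P zero    P-term = P-term 0 z≤n
  convUpTo-all P P+P (suc t) P-term =
    P+P (convUpTo-all P P+P t (λ i i≤t → P-term i (ℕP.m≤n⇒m≤1+n i≤t))) (P-term (suc t) ℕP.≤-refl)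

  convUpTo-one : ∀ (P Q : ℚ → Set) → (∀ {x y} → P x → P y → P (x ℚ.+ y)) →
                 (∀ {x y} → Q x → P y → Q (x ℚ.+ y)) → (∀ {x y} → P x → Q y → Q (x ℚ.+ y)) →
                 ∀ t {i} → i ≤ t → Q (term i) → (∀ j → j ≤ t → j ≢ i → P (term j)) →
                 Q (convUpTo f g m t)
  convUpTo-one P Q P+P Q+P P+Q zero    z≤n Q-term _ = Q-term
  convUpTo-one P Q P+P Q+P P+Q (suc t) {i} i≤1+t Q-term P-term with i ℕP.≟ suc t
  ... | yes refl = P+Q (convUpTo-all P P+P t (λ j j≤t → P-term j (ℕP.m≤n⇒m≤1+n j≤t) (ℕP.<⇒≢ (s≤s j≤t))))
                       Q-term
  ... | no i≢1+t = Q+P (convUpTo-one P Q P+P Q+P P+Q t (ℕP.≤-pred (ℕP.≤∧≢⇒< i≤1+t i≢1+t)) Q-term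
                          (λ j j≤t → P-term j (ℕP.m≤n⇒m≤1+n j≤t)))
                       (P-term (suc t) ℕP.≤-refl (i≢1+t ∘ sym))

hasDegree-unique : ∀ {d e f} → HasDegree d f → HasDegree e f → d ≡ e
hasDegree-unique {d} {e} (fd≢0 , f>d≡0) (fe≢0 , f>e≡0) with ℕP.<-cmp d e
... | tri< d<e _ _ = contradiction (f>d≡0 e d<e) fe≢0
... | tri≈ _ d≡e _ = d≡e
... | tri> _ _ e<d = contradiction (f>e≡0 d e<d) fd≢0

module _ {g h : ℕ → ℚ} {d₁ d₂ : ℕ} (deg-g : HasDegree d₁ g) (deg-h : HasDegree d₂ h) where

  private
    term-vanishes : ∀ {M i} → d₁ + d₂ < M ⊎ (M ≡ d₁ + d₂ × i ≢ d₁) → g i ℚ.* h (M ∸ i) ≡ 0ℚ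
    term-vanishes {M} {i} d₁+d₂≲M with a<i⊎b<M∸i d₁+d₂≲M
    ... | inj₁ d₁<i   = trans (cong (ℚ._* h (M ∸ i)) (proj₂ deg-g i d₁<i)) (ℚP.*-zeroˡ (h (M ∸ i)))
    ... | inj₂ d₂<M∸i = trans (cong (g i ℚ.*_) (proj₂ deg-h (M ∸ i) d₂<M∸i)) (ℚP.*-zeroʳ (g i))

    0+0≡0 : ∀ {x y} → x ≡ 0ℚ → y ≡ 0ℚ → x ℚ.+ y ≡ 0ℚ
    0+0≡0 refl refl = refl

  ·ₚ-leading : (g ·ₚ h) (d₁ + d₂) ≡ g d₁ ℚ.* h d₂
  ·ₚ-leading = Convolution.convUpTo-one g h (d₁ + d₂) (_≡ 0ℚ) (_≡ g d₁ ℚ.* h d₂) 0+0≡0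
    (λ { x≡ refl → trans (ℚP.+-identityʳ _) x≡ }) (λ { refl y≡ → trans (ℚP.+-identityˡ _) y≡ })
    (d₁ + d₂) (ℕP.m≤m+n d₁ d₂) (cong (λ j → g d₁ ℚ.* h j) (ℕP.m+n∸m≡n d₁ d₂))
    (λ j _ j≢d₁ → term-vanishes (inj₂ (refl , j≢d₁)))

  ·ₚ-hasDegree : HasDegree (d₁ + d₂) (g ·ₚ h)
  ·ₚ-hasDegree = subst (_≢ 0ℚ) (sym ·ₚ-leading) (*-≢0ℚ (proj₁ deg-g) (proj₁ deg-h))
               , λ M d₁+d₂<M → Convolution.convUpTo-all g h M (_≡ 0ℚ) 0+0≡0 M
                   (λ i _ → term-vanishes (inj₁ d₁+d₂<M))

module Valuation (p : ℕ) (p-prime : Prime p) where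

  open Prime p-prime

  instance
    p≢0 : NonZero p
    p≢0 = ℕ.nonTrivial⇒nonZero p

  1<p : 1 < p
  1<p = ℕ.nonTrivial⇒n>1 p

  record Factorisation (m : ℕ) : Set where
    constructor factorisation
    field
      exponent cofactor : ℕ
      m≡p^exponent*cofactor : m ≡ p ^ exponent * cofactor
      p∤cofactor : m ≢ 0 → p ∤ cofactor

  factorise : ∀ m → Factorisation m
  factorise = <-rec Factorisation step
    where
    step : ∀ m → (∀ {m′} → m′ < m → Factorisation m′) → Factorisation m
    step zero    _ = factorisation 0 0 refl (λ 0≢0 → contradiction refl 0≢0)
    step (suc m) rec with p ∣? suc m
    ... | no p∤m = factorisation 0 (suc m) (sym (ℕP.*-identityˡ (suc m))) (λ _ → p∤m)
    ... | yes (divides q m≡q*p) = factorisation (suc e) w m≡p^[1+e]*w (λ _ → p∤w (ℕ.≢-nonZero⁻¹ q))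
      where
      instance
        q≢0 : NonZero q
        q≢0 = ℕ.≢-nonZero λ { refl → ℕP.0≢1+n (sym m≡q*p) }
      open Factorisation (rec (subst (q <_) (sym m≡q*p) (ℕP.m<m*n q p 1<p)))
        renaming (exponent to e; cofactor to w; m≡p^exponent*cofactor to q≡p^e*w; p∤cofactor to p∤w)
      m≡p^[1+e]*w : suc m ≡ p ^ suc e * w
      m≡p^[1+e]*w = begin
        suc m           ≡⟨ m≡q*p ⟩
        q * p           ≡⟨ cong (_* p) q≡p^e*w ⟩
        p ^ e * w * p   ≡⟨ ℕP.*-comm (p ^ e * w) p ⟩
        p * (p ^ e * w) ≡⟨ ℕP.*-assoc p (p ^ e) w ⟨
        p ^ suc e * w   ∎
        where open ≡-Reasoning

  -- junk value: ν 0 = 0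
  ν : ℕ → ℕ
  ν m = Factorisation.exponent (factorise m)

  private
    module F m = Factorisation (factorise m)

  p∤1 : p ∤ 1
  p∤1 p∣1 = ℕP.<⇒≱ 1<p (∣⇒≤ p∣1)

  p∤*-closed : ∀ {a b} → p ∤ a → p ∤ b → p ∤ a * b
  p∤*-closed {a} {b} p∤a p∤b p∣ab with euclidsLemma a b p-prime p∣ab
  ... | inj₁ p∣a = p∤a p∣a
  ... | inj₂ p∣b = p∤b p∣b

  p^e*w≢0 : ∀ e {w} → p ∤ w → p ^ e * w ≢ 0
  p^e*w≢0 e p∤w eq with ℕP.m*n≡0⇒m≡0∨n≡0 (p ^ e) eq
  ... | inj₁ p^e≡0 = ℕ.≢-nonZero⁻¹ (p ^ e) {{ℕP.m^n≢0 p e}} p^e≡0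
  ... | inj₂ refl  = p∤w (p ∣0)

  exponent-unique : ∀ e f {w u} → p ^ e * w ≡ p ^ f * u → p ∤ w → p ∤ u → e ≡ f
  exponent-unique zero    zero    _  _   _   = refl
  exponent-unique zero    (suc f) {w} {u} eq p∤w _ =
    ⊥-elim (p∤w (divides (p ^ f * u) (trans (sym (ℕP.*-identityˡ w))
      (trans eq (trans (ℕP.*-assoc p (p ^ f) u) (ℕP.*-comm p (p ^ f * u)))))))
  exponent-unique (suc e) zero    eq p∤w p∤u = sym (exponent-unique zero (suc e) (sym eq) p∤u p∤w)
  exponent-unique (suc e) (suc f) {w} {u} eq p∤w p∤u = cong suc (exponent-unique e f
    (ℕP.*-cancelˡ-≡ (p ^ e * w) (p ^ f * u) p
      (trans (sym (ℕP.*-assoc p (p ^ e) w)) (trans eq (ℕP.*-assoc p (p ^ f) u)))) p∤w p∤u)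

  ν-p^e*w : ∀ e {w} → p ∤ w → ν (p ^ e * w) ≡ e
  ν-p^e*w e p∤w = exponent-unique _ e (sym (F.m≡p^exponent*cofactor _))
    (F.p∤cofactor _ (p^e*w≢0 e p∤w)) p∤w

  ν-* : ∀ {m n} → m ≢ 0 → n ≢ 0 → ν (m * n) ≡ ν m + ν n
  ν-* {m} {n} m≢0 n≢0 = trans (cong ν m*n≡) (ν-p^e*w (ν m + ν n)
    (p∤*-closed (F.p∤cofactor m m≢0) (F.p∤cofactor n n≢0)))
    where
    open ≡-Reasoning
    m*n≡ : m * n ≡ p ^ (ν m + ν n) * (F.cofactor m * F.cofactor n)
    m*n≡ = begin
      m * n
        ≡⟨ cong₂ _*_ (F.m≡p^exponent*cofactor m) (F.m≡p^exponent*cofactor n) ⟩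
      (p ^ ν m * F.cofactor m) * (p ^ ν n * F.cofactor n)
        ≡⟨ interchange (p ^ ν m) (F.cofactor m) (p ^ ν n) (F.cofactor n) ⟩
      p ^ ν m * p ^ ν n * (F.cofactor m * F.cofactor n)
        ≡⟨ cong (_* (F.cofactor m * F.cofactor n)) (ℕP.^-distribˡ-+-* p (ν m) (ν n)) ⟨
      p ^ (ν m + ν n) * (F.cofactor m * F.cofactor n)
        ∎

  ν≡0 : ∀ {w} → p ∤ w → ν w ≡ 0
  ν≡0 {w} p∤w = trans (cong ν (sym (ℕP.*-identityˡ w))) (ν-p^e*w 0 p∤w)

  ν≡1 : ∀ {w} → p ∣ w → p ^ 2 ∤ w → ν w ≡ 1
  ν≡1 {w} (divides q w≡q*p) p²∤w = trans (cong ν w≡p^1*q) (ν-p^e*w 1 p∤q)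
    where
    w≡p^1*q : w ≡ p ^ 1 * q
    w≡p^1*q = trans w≡q*p (trans (ℕP.*-comm q p) (cong (_* q) (sym (ℕP.*-identityʳ p))))
    p∤q : p ∤ q
    p∤q (divides r q≡r*p) = p²∤w (divides r (begin
      w           ≡⟨ w≡q*p ⟩
      q * p       ≡⟨ cong (_* p) q≡r*p ⟩
      r * p * p   ≡⟨ ℕP.*-assoc r p p ⟩
      r * (p * p) ≡⟨ cong (λ x → r * (p * x)) (ℕP.*-identityʳ p) ⟨
      r * p ^ 2   ∎))
      where open ≡-Reasoning

  p^e∣p^f : ∀ {e f} → e ≤ f → p ^ e ∣ p ^ f
  p^e∣p^f {e} {f} e≤f = divides (p ^ (f ∸ e))
    (trans (cong (p ^_) (sym (ℕP.m∸n+n≡m e≤f))) (ℕP.^-distribˡ-+-* p (f ∸ e) e))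

  ≤ν⇒p^e∣ : ∀ {e m} → e ≤ ν m → p ^ e ∣ m
  ≤ν⇒p^e∣ {e} {m} e≤νm = ∣-trans (p^e∣p^f e≤νm)
    (divides (F.cofactor m) (trans (F.m≡p^exponent*cofactor m) (ℕP.*-comm (p ^ ν m) _)))

  p^e∣⇒≤ν : ∀ {e m} → m ≢ 0 → p ^ e ∣ m → e ≤ ν m
  p^e∣⇒≤ν {e} {m} m≢0 p^e∣m with e ℕ.≤? ν m
  ... | yes e≤νm = e≤νm
  ... | no  e≰νm = contradiction p∣cofactor (F.p∤cofactor m m≢0)
    where
    p^[1+νm]∣m : p ^ ν m * p ∣ p ^ ν m * F.cofactor m
    p^[1+νm]∣m = subst₂ _∣_ (ℕP.*-comm p (p ^ ν m)) (F.m≡p^exponent*cofactor m)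
      (∣-trans (p^e∣p^f (ℕP.≰⇒> e≰νm)) p^e∣m)
    p∣cofactor : p ∣ F.cofactor m
    p∣cofactor = *-cancelˡ-∣ (p ^ ν m) {{ℕP.m^n≢0 p (ν m)}} p^[1+νm]∣m

  νℤ : ℤ → ℕ
  νℤ z = ν ∣ z ∣

  private
    ∣∣≢0 : ∀ {z} → z ≢ 0ℤ → ∣ z ∣ ≢ 0
    ∣∣≢0 z≢0 ∣z∣≡0 = z≢0 (ℤP.∣i∣≡0⇒i≡0 ∣z∣≡0)

    p^e∣ℤ : ∀ {e} z → e ≤ νℤ z → + (p ^ e) ℤD.∣ z
    p^e∣ℤ z e≤νz = ℤD.∣ᵤ⇒∣ (≤ν⇒p^e∣ e≤νz)

  νℤ-* : ∀ {i j} → i ≢ 0ℤ → j ≢ 0ℤ → νℤ (i ℤ.* j) ≡ νℤ i + νℤ j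
  νℤ-* {i} {j} i≢0 j≢0 = trans (cong ν (ℤP.abs-* i j)) (ν-* (∣∣≢0 i≢0) (∣∣≢0 j≢0))

  νℤ-+-≥ : ∀ {e} A B → e ≤ νℤ A → e ≤ νℤ B → A ℤ.+ B ≢ 0ℤ → e ≤ νℤ (A ℤ.+ B)
  νℤ-+-≥ A B e≤νA e≤νB A+B≢0 =
    p^e∣⇒≤ν (∣∣≢0 A+B≢0) (ℤD.∣⇒∣ᵤ (ℤD.∣m∣n⇒∣m+n (p^e∣ℤ A e≤νA) (p^e∣ℤ B e≤νB)))

  νℤ-+-< : ∀ A B → A ≢ 0ℤ → νℤ A < νℤ B → (A ℤ.+ B ≢ 0ℤ) × (νℤ (A ℤ.+ B) ≡ νℤ A)
  νℤ-+-< A B A≢0 νA<νB = A+B≢0 , ℕP.≤-antisym νA+B≤νA (νℤ-+-≥ A B ℕP.≤-refl (ℕP.<⇒≤ νA<νB) A+B≢0)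
    where
    p^[1+νA]∤A+B : p ^ suc (νℤ A) ∤ ∣ A ℤ.+ B ∣
    p^[1+νA]∤A+B p^[1+νA]∣A+B = ℕP.<-irrefl refl (p^e∣⇒≤ν (∣∣≢0 A≢0)
      (ℤD.∣⇒∣ᵤ (ℤD.∣m+n∣n⇒∣m {m = A} (ℤD.∣ᵤ⇒∣ p^[1+νA]∣A+B) (p^e∣ℤ B νA<νB))))
    A+B≢0 : A ℤ.+ B ≢ 0ℤ
    A+B≢0 A+B≡0 = p^[1+νA]∤A+B (subst (λ z → p ^ suc (νℤ A) ∣ ∣ z ∣) (sym A+B≡0) ((p ^ suc (νℤ A)) ∣0))
    νA+B≤νA : νℤ (A ℤ.+ B) ≤ νℤ A
    νA+B≤νA = ℕP.≮⇒≥ (λ νA<νA+B → p^[1+νA]∤A+B (≤ν⇒p^e∣ νA<νA+B))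

  νℚ : ℚ → ℤ
  νℚ x = + νℤ (↥ x) ℤ.- + νℤ (↧ x)

  νℚ-scale : ∀ x {X A B} → ↥ x ℤ.* X ≡ A → ↧ x ℤ.* X ≡ B → A ≢ 0ℤ → νℚ x ≡ + νℤ A ℤ.- + νℤ B
  νℚ-scale x {X} refl refl A≢0 = sym (begin
    + νℤ (↥ x ℤ.* X) ℤ.- + νℤ (↧ x ℤ.* X)
      ≡⟨ cong₂ (λ a b → + a ℤ.- + b) (νℤ-* (↥≢0 (≢0-numerator {x} refl A≢0)) X≢0) (νℤ-* (↧≢0 x) X≢0) ⟩
    + (νℤ (↥ x) + νℤ X) ℤ.- + (νℤ (↧ x) + νℤ X)
      ≡⟨ cong₂ ℤ._-_ (ℤP.pos-+ (νℤ (↥ x)) (νℤ X)) (ℤP.pos-+ (νℤ (↧ x)) (νℤ X)) ⟩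
    (+ νℤ (↥ x) ℤ.+ + νℤ X) ℤ.- (+ νℤ (↧ x) ℤ.+ + νℤ X)
      ≡⟨ cancel (+ νℤ (↥ x)) (+ νℤ (↧ x)) (+ νℤ X) ⟩
    νℚ x ∎)
    where
    open ≡-Reasoning
    X≢0 : X ≢ 0ℤ
    X≢0 = ≢0-factorʳ {↥ x} A≢0
    cancel : ∀ a b c → (a ℤ.+ c) ℤ.- (b ℤ.+ c) ≡ a ℤ.- b
    cancel = solve-∀

  νℚ-* : ∀ {x y} → x ≢ 0ℚ → y ≢ 0ℚ → νℚ (x ℚ.* y) ≡ νℚ x ℤ.+ νℚ y
  νℚ-* {x} {y} x≢0 y≢0 = begin
    νℚ (x ℚ.* y)
      ≡⟨ νℚ-scale (x ℚ.* y) (ℚP.↥-* x y) (ℚP.↧-* x y) (*-≢0ℤ (↥≢0 x≢0) (↥≢0 y≢0)) ⟩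
    + νℤ (↥ x ℤ.* ↥ y) ℤ.- + νℤ (↧ x ℤ.* ↧ y)
      ≡⟨ cong₂ (λ a b → + a ℤ.- + b) (νℤ-* (↥≢0 x≢0) (↥≢0 y≢0)) (νℤ-* (↧≢0 x) (↧≢0 y)) ⟩
    + (νℤ (↥ x) + νℤ (↥ y)) ℤ.- + (νℤ (↧ x) + νℤ (↧ y))
      ≡⟨ cong₂ ℤ._-_ (ℤP.pos-+ (νℤ (↥ x)) _) (ℤP.pos-+ (νℤ (↧ x)) _) ⟩
    (+ νℤ (↥ x) ℤ.+ + νℤ (↥ y)) ℤ.- (+ νℤ (↧ x) ℤ.+ + νℤ (↧ y))
      ≡⟨ regroup (+ νℤ (↥ x)) (+ νℤ (↥ y)) (+ νℤ (↧ x)) (+ νℤ (↧ y)) ⟩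
    νℚ x ℤ.+ νℚ y ∎
    where
    open ≡-Reasoning
    regroup : ∀ a b c d → (a ℤ.+ b) ℤ.- (c ℤ.+ d) ≡ (a ℤ.- c) ℤ.+ (b ℤ.- d)
    regroup = solve-∀

  private module CommonDenominator {x y} (x≢0 : x ≢ 0ℚ) (y≢0 : y ≢ 0ℚ) where
    A B D : ℤ
    A = ↥ x ℤ.* ↧ y
    B = ↥ y ℤ.* ↧ x
    D = ↧ x ℤ.* ↧ y

    A≢0 : A ≢ 0ℤ
    A≢0 = *-≢0ℤ (↥≢0 x≢0) (↧≢0 y)

    νx : νℚ x ≡ + νℤ A ℤ.- + νℤ D
    νx = νℚ-scale x refl refl A≢0

    νy : νℚ y ≡ + νℤ B ℤ.- + νℤ D
    νy = νℚ-scale y refl (ℤP.*-comm (↧ y) (↧ x)) (*-≢0ℤ (↥≢0 y≢0) (↧≢0 x))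

    A+B≢0 : x ℚ.+ y ≢ 0ℚ → A ℤ.+ B ≢ 0ℤ
    A+B≢0 x+y≢0 A+B≡0 with ℤP.i*j≡0⇒i≡0∨j≡0 (↥ (x ℚ.+ y)) (trans (ℚP.↥-+ x y) A+B≡0)
    ... | inj₁ ↥≡0  = ↥≢0 x+y≢0 ↥≡0
    ... | inj₂ nf≡0 = *-≢0ℤ (↧≢0 x) (↧≢0 y)
      (trans (sym (ℚP.↧-+ x y)) (trans (cong (↧ (x ℚ.+ y) ℤ.*_) nf≡0) (ℤP.*-zeroʳ (↧ (x ℚ.+ y)))))

    νx+y : x ℚ.+ y ≢ 0ℚ → νℚ (x ℚ.+ y) ≡ + νℤ (A ℤ.+ B) ℤ.- + νℤ D
    νx+y x+y≢0 = νℚ-scale (x ℚ.+ y) (ℚP.↥-+ x y) (ℚP.↧-+ x y) (A+B≢0 x+y≢0)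

  νℚ-+-≥ : ∀ {e x y} → x ≢ 0ℚ → y ≢ 0ℚ → x ℚ.+ y ≢ 0ℚ →
           e ℤ.≤ νℚ x → e ℤ.≤ νℚ y → e ℤ.≤ νℚ (x ℚ.+ y)
  νℚ-+-≥ {e} {x} {y} x≢0 y≢0 x+y≢0 e≤νx e≤νy =
    [ (λ νA≤νB → via {x} e≤νx νx (νℤ-+-≥ A B ℕP.≤-refl νA≤νB (A+B≢0 x+y≢0)))
    , (λ νB≤νA → via {y} e≤νy νy (νℤ-+-≥ A B νB≤νA ℕP.≤-refl (A+B≢0 x+y≢0)))
    ]′ (ℕP.≤-total (νℤ A) (νℤ B))
    where
    open CommonDenominator x≢0 y≢0
    via : ∀ {z a} → e ℤ.≤ νℚ z → νℚ z ≡ + a ℤ.- + νℤ D → a ≤ νℤ (A ℤ.+ B) → e ℤ.≤ νℚ (x ℚ.+ y)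
    via {z} {a} e≤νz νz≡ a≤νA+B = begin
      e                             ≤⟨ e≤νz ⟩
      νℚ z                          ≡⟨ νz≡ ⟩
      + a ℤ.- + νℤ D                ≤⟨ ℤP.+-monoˡ-≤ (ℤ.- + νℤ D) (ℤ.+≤+ a≤νA+B) ⟩
      + νℤ (A ℤ.+ B) ℤ.- + νℤ D     ≡⟨ νx+y x+y≢0 ⟨
      νℚ (x ℚ.+ y)                  ∎
      where open ℤP.≤-Reasoning

  νℚ-+-< : ∀ {x y} → x ≢ 0ℚ → y ≢ 0ℚ → νℚ x ℤ.< νℚ y → (x ℚ.+ y ≢ 0ℚ) × (νℚ (x ℚ.+ y) ≡ νℚ x)
  νℚ-+-< {x} {y} x≢0 y≢0 νx<νy = x+y≢0 , (begin
    νℚ (x ℚ.+ y)                    ≡⟨ νx+y x+y≢0 ⟩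
    + νℤ (A ℤ.+ B) ℤ.- + νℤ D        ≡⟨ cong (λ a → + a ℤ.- + νℤ D) (proj₂ A+B) ⟩
    + νℤ A ℤ.- + νℤ D                ≡⟨ νx ⟨
    νℚ x                            ∎)
    where
    open CommonDenominator x≢0 y≢0
    open ≡-Reasoning
    νA<νB : νℤ A < νℤ B
    νA<νB = ℕP.≰⇒> (λ νB≤νA → ℤP.<⇒≱ (subst₂ ℤ._<_ νx νy νx<νy) (ℤP.+-monoˡ-≤ (ℤ.- + νℤ D) (ℤ.+≤+ νB≤νA)))
    A+B : (A ℤ.+ B ≢ 0ℤ) × (νℤ (A ℤ.+ B) ≡ νℤ A)
    A+B = νℤ-+-< A B A≢0 νA<νB
    x+y≢0 : x ℚ.+ y ≢ 0ℚ
    x+y≢0 = ≢0-numerator (ℚP.↥-+ x y) (proj₁ A+B)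

  infix 4 ν[_]≥_ ν[_]≡_

  -- the zero coefficient counts as having valuation +∞
  ν[_]≥_ : ℚ → ℤ → Set
  ν[ x ]≥ e = x ≡ 0ℚ ⊎ (x ≢ 0ℚ × e ℤ.≤ νℚ x)

  ν[_]≡_ : ℚ → ℤ → Set
  ν[ x ]≡ e = x ≢ 0ℚ × νℚ x ≡ e

  ≡⇒≥ : ∀ {x e} → ν[ x ]≡ e → ν[ x ]≥ e
  ≡⇒≥ (x≢0 , νx≡e) = inj₂ (x≢0 , ℤP.≤-reflexive (sym νx≡e))

  ≥-weaken : ∀ {x e f} → f ℤ.≤ e → ν[ x ]≥ e → ν[ x ]≥ f
  ≥-weaken f≤e (inj₁ x≡0)          = inj₁ x≡0
  ≥-weaken f≤e (inj₂ (x≢0 , e≤νx)) = inj₂ (x≢0 , ℤP.≤-trans f≤e e≤νx)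

  ≡∧≥⇒≤ : ∀ {x e f} → ν[ x ]≡ e → ν[ x ]≥ f → f ℤ.≤ e
  ≡∧≥⇒≤ (x≢0 , _)    (inj₁ x≡0)        = contradiction x≡0 x≢0
  ≡∧≥⇒≤ (_ , νx≡e)   (inj₂ (_ , f≤νx)) = subst (_ ℤ.≤_) νx≡e f≤νx

  ≡∧>⇒⊥ : ∀ {x e} → ν[ x ]≡ e → ¬ ν[ x ]≥ ℤ.suc e
  ≡∧>⇒⊥ ν≡e ν>e = ℤP.<-irrefl refl (ℤP.suc[i]≤j⇒i<j (≡∧≥⇒≤ ν≡e ν>e))

  ≥-+ : ∀ {x y e} → ν[ x ]≥ e → ν[ y ]≥ e → ν[ x ℚ.+ y ]≥ e
  ≥-+ {y = y} (inj₁ refl) νy≥e = subst (ν[_]≥ _) (sym (ℚP.+-identityˡ y)) νy≥e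
  ≥-+ {x = x} νx≥e (inj₁ refl) = subst (ν[_]≥ _) (sym (ℚP.+-identityʳ x)) νx≥e
  ≥-+ {x} {y} (inj₂ (x≢0 , e≤νx)) (inj₂ (y≢0 , e≤νy)) with x ℚ.+ y ℚP.≟ 0ℚ
  ... | yes x+y≡0 = inj₁ x+y≡0
  ... | no  x+y≢0 = inj₂ (x+y≢0 , νℚ-+-≥ x≢0 y≢0 x+y≢0 e≤νx e≤νy)

  ≥-* : ∀ {x y e f} → ν[ x ]≥ e → ν[ y ]≥ f → ν[ x ℚ.* y ]≥ e ℤ.+ f
  ≥-* {y = y} (inj₁ refl) _           = inj₁ (ℚP.*-zeroˡ y)
  ≥-* {x = x} _           (inj₁ refl) = inj₁ (ℚP.*-zeroʳ x)
  ≥-* (inj₂ (x≢0 , e≤νx)) (inj₂ (y≢0 , f≤νy)) =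
    inj₂ (*-≢0ℚ x≢0 y≢0 , subst (_ ℤ.≤_) (sym (νℚ-* x≢0 y≢0)) (ℤP.+-mono-≤ e≤νx f≤νy))

  ≡-* : ∀ {x y e f} → ν[ x ]≡ e → ν[ y ]≡ f → ν[ x ℚ.* y ]≡ e ℤ.+ f
  ≡-* (x≢0 , νx≡e) (y≢0 , νy≡f) = *-≢0ℚ x≢0 y≢0 , trans (νℚ-* x≢0 y≢0) (cong₂ ℤ._+_ νx≡e νy≡f)

  ≡-+-> : ∀ {x y e} → ν[ x ]≡ e → ν[ y ]≥ ℤ.suc e → ν[ x ℚ.+ y ]≡ e
  ≡-+-> {x} νx≡e (inj₁ refl) = subst (ν[_]≡ _) (sym (ℚP.+-identityʳ x)) νx≡e
  ≡-+-> (x≢0 , refl) (inj₂ (y≢0 , νx<νy)) = νℚ-+-< x≢0 y≢0 (ℤP.suc[i]≤j⇒i<j νx<νy)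

  >-+-≡ : ∀ {x y e} → ν[ x ]≥ ℤ.suc e → ν[ y ]≡ e → ν[ x ℚ.+ y ]≡ e
  >-+-≡ {x} {y} νx>e νy≡e = subst (ν[_]≡ _) (ℚP.+-comm y x) (≡-+-> νy≡e νx>e)

  νℚ-integer : ∀ {z} → z ≢ 0ℤ → ν[ z ℚ./ 1 ]≡ + νℤ z
  νℚ-integer {z} z≢0 = ≢0-numerator (ℚP.↥-/ z 1) z≢0 , (begin
    νℚ (z ℚ./ 1)            ≡⟨ νℚ-scale (z ℚ./ 1) (ℚP.↥-/ z 1) (ℚP.↧-/ z 1) z≢0 ⟩
    + νℤ z ℤ.- + ν 1        ≡⟨ cong (λ e → + νℤ z ℤ.- + e) (ν≡0 p∤1) ⟩
    + νℤ z ℤ.- 0ℤ           ≡⟨ ℤP.+-identityʳ (+ νℤ z) ⟩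
    + νℤ z                  ∎)
    where open ≡-Reasoning

module NewtonPolygon (p : ℕ) (p-prime : Prime p) where

  open Valuation p p-prime

  record MinimalValuationUpTo (N : ℕ) (g : ℕ → ℚ) : Set where
    field
      min         : ℤ
      first last  : ℕ
      first≤last  : first ≤ last
      last≤N      : last ≤ N
      ν-first     : ν[ g first ]≡ min
      ν-last      : ν[ g last ]≡ min
      ν-≥         : ∀ j → j ≤ N → ν[ g j ]≥ min
      ν-<first    : ∀ j → j < first → ν[ g j ]≥ ℤ.suc min
      ν->last     : ∀ j → j ≤ N → last < j → ν[ g j ]≥ ℤ.suc min

  record MinimalValuation (g : ℕ → ℚ) : Set where
    field
      min         : ℤ
      first last  : ℕ
      first≤last  : first ≤ last
      ν-first     : ν[ g first ]≡ min
      ν-last      : ν[ g last ]≡ min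
      ν-≥         : ∀ j → ν[ g j ]≥ min
      ν-<first    : ∀ j → j < first → ν[ g j ]≥ ℤ.suc min
      ν->last     : ∀ j → last < j → ν[ g j ]≥ ℤ.suc min

  module _ {g : ℕ → ℚ} where

    private
      ≤1+n-split : ∀ {j N} → j ≤ suc N → j ≤ N ⊎ j ≡ suc N
      ≤1+n-split j≤1+N = Sum.map₁ ℕP.≤-pred (ℕP.m≤n⇒m<n∨m≡n j≤1+N)

    startAt : ∀ {N e} → ν[ g N ]≡ e → (∀ j → j < N → ν[ g j ]≥ ℤ.suc e) → MinimalValuationUpTo N g
    startAt {N} {e} νgN≡e ν<N = record
      { min = e ; first = N ; last = N ; first≤last = ℕP.≤-refl ; last≤N = ℕP.≤-refl
      ; ν-first = νgN≡e ; ν-last = νgN≡e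
      ; ν-≥ = λ j j≤N → [ ≥-weaken (ℤP.i≤suc[i] e) ∘ ν<N j , (λ { refl → ≡⇒≥ νgN≡e }) ]′
                          (ℕP.m≤n⇒m<n∨m≡n j≤N)
      ; ν-<first = ν<N
      ; ν->last = λ j j≤N N<j → contradiction j≤N (ℕP.<⇒≱ N<j)
      }

    module _ {N} (M : MinimalValuationUpTo N g) where
      open MinimalValuationUpTo M

      extendAbove : ν[ g (suc N) ]≥ ℤ.suc min → MinimalValuationUpTo (suc N) g
      extendAbove ν>min = record
        { min = min ; first = first ; last = last ; first≤last = first≤last
        ; last≤N = ℕP.m≤n⇒m≤1+n last≤N ; ν-first = ν-first ; ν-last = ν-last
        ; ν-≥ = λ j j≤1+N → [ ν-≥ j , (λ { refl → ≥-weaken (ℤP.i≤suc[i] min) ν>min }) ]′ (≤1+n-split j≤1+N)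
        ; ν-<first = ν-<first
        ; ν->last = λ j j≤1+N last<j → [ (λ j≤N → ν->last j j≤N last<j) , (λ { refl → ν>min }) ]′
                                          (≤1+n-split j≤1+N)
        }

      extendEqual : ν[ g (suc N) ]≡ min → MinimalValuationUpTo (suc N) g
      extendEqual ν≡min = record
        { min = min ; first = first ; last = suc N
        ; first≤last = ℕP.≤-trans first≤last (ℕP.m≤n⇒m≤1+n last≤N) ; last≤N = ℕP.≤-refl
        ; ν-first = ν-first ; ν-last = ν≡min
        ; ν-≥ = λ j j≤1+N → [ ν-≥ j , (λ { refl → ≡⇒≥ ν≡min }) ]′ (≤1+n-split j≤1+N)
        ; ν-<first = ν-<first
        ; ν->last = λ j j≤1+N 1+N<j → contradiction j≤1+N (ℕP.<⇒≱ 1+N<j)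
        }

      extendBelow : ∀ {e} → ν[ g (suc N) ]≡ e → e ℤ.< min → MinimalValuationUpTo (suc N) g
      extendBelow ν≡e e<min =
        startAt ν≡e (λ j j<1+N → ≥-weaken (ℤP.i<j⇒suc[i]≤j e<min) (ν-≥ j (ℕP.≤-pred j<1+N)))

      extend : MinimalValuationUpTo (suc N) g
      extend with g (suc N) ℚP.≟ 0ℚ
      ... | yes g≡0 = extendAbove (inj₁ g≡0)
      ... | no  g≢0 with ℤP.<-cmp (νℚ (g (suc N))) min
      ...   | tri< ν<min _ _ = extendBelow (g≢0 , refl) ν<min
      ...   | tri≈ _ ν≡min _ = extendEqual (g≢0 , ν≡min)
      ...   | tri> _ _ min<ν = extendAbove (inj₂ (g≢0 , ℤP.i<j⇒suc[i]≤j min<ν))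

    minimalValuationUpTo : ∀ N → (∀ j → j ≤ N → g j ≡ 0ℚ) ⊎ MinimalValuationUpTo N g
    minimalValuationUpTo zero with g 0 ℚP.≟ 0ℚ
    ... | yes g0≡0 = inj₁ λ { .0 z≤n → g0≡0 }
    ... | no  g0≢0 = inj₂ (startAt (g0≢0 , refl) (λ _ ()))
    minimalValuationUpTo (suc N) with minimalValuationUpTo N
    ... | inj₂ M = inj₂ (extend M)
    ... | inj₁ g≤N≡0 with g (suc N) ℚP.≟ 0ℚ
    ...   | yes g≡0 = inj₁ λ j j≤1+N → [ g≤N≡0 j , (λ { refl → g≡0 }) ]′ (≤1+n-split j≤1+N)
    ...   | no  g≢0 = inj₂ (startAt (g≢0 , refl) (λ j j<1+N → inj₁ (g≤N≡0 j (ℕP.≤-pred j<1+N))))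

    minimalValuation : ∀ {d} → HasDegree d g → MinimalValuation g
    minimalValuation {d} (gd≢0 , g>d≡0) with minimalValuationUpTo d
    ... | inj₁ g≤d≡0 = contradiction (g≤d≡0 d ℕP.≤-refl) gd≢0
    ... | inj₂ M = record
      { min = min ; first = first ; last = last ; first≤last = first≤last
      ; ν-first = ν-first ; ν-last = ν-last
      ; ν-≥ = λ j → [ ν-≥ j , (λ d<j → inj₁ (g>d≡0 j d<j)) ]′ (ℕP.≤-<-connex j d)
      ; ν-<first = ν-<first
      ; ν->last = λ j last<j → [ (λ j≤d → ν->last j j≤d last<j) , (λ d<j → inj₁ (g>d≡0 j d<j)) ]′
                                   (ℕP.≤-<-connex j d)
      }
      where open MinimalValuationUpTo M

  module _ {f : ℕ → ℚ} (M : MinimalValuation f) where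
    open MinimalValuation M

    off-minimum : first ≡ last → ∀ {i} → i ≢ first → ν[ f i ]≥ ℤ.suc min
    off-minimum first≡last {i} i≢first with ℕP.<-cmp i first
    ... | tri< i<first _ _ = ν-<first i i<first
    ... | tri≈ _ i≡first _ = contradiction i≡first i≢first
    ... | tri> _ _ first<i = ν->last i (subst (_< i) first≡last first<i)

  module _ {g h : ℕ → ℚ} (MG : MinimalValuation g) (MH : MinimalValuation h) where
    private
      module G = MinimalValuation MG
      module H = MinimalValuation MH

      E : ℤ
      E = G.min ℤ.+ H.min

      suc-+ : ∀ a b → (1ℤ ℤ.+ a) ℤ.+ b ≡ 1ℤ ℤ.+ (a ℤ.+ b)
      suc-+ = solve-∀

      +-suc : ∀ a b → a ℤ.+ (1ℤ ℤ.+ b) ≡ 1ℤ ℤ.+ (a ℤ.+ b)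
      +-suc = solve-∀

      product-above-min : ∀ {i j} → ν[ g i ]≥ ℤ.suc G.min ⊎ ν[ h j ]≥ ℤ.suc H.min → ν[ g i ℚ.* h j ]≥ ℤ.suc E
      product-above-min {j = j} (inj₁ νgi>) = subst (ν[ _ ]≥_) (suc-+ G.min H.min) (≥-* νgi> (H.ν-≥ j))
      product-above-min {i = i} (inj₂ νhj>) = subst (ν[ _ ]≥_) (+-suc G.min H.min) (≥-* (G.ν-≥ i) νhj>)

      ν-corner : ∀ {a b} → ν[ g a ]≡ G.min → ν[ h b ]≡ H.min →
                 (∀ i → i ≤ a + b → i ≢ a → ν[ g i ]≥ ℤ.suc G.min ⊎ ν[ h (a + b ∸ i) ]≥ ℤ.suc H.min) →
                 ν[ (g ·ₚ h) (a + b) ]≡ E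
      ν-corner {a} {b} νga νhb off-corner = Convolution.convUpTo-one g h (a + b)
        (ν[_]≥ ℤ.suc E) (ν[_]≡ E) ≥-+ ≡-+-> >-+-≡ (a + b) (ℕP.m≤m+n a b)
        (subst (λ j → ν[ g a ℚ.* h j ]≡ E) (sym (ℕP.m+n∸m≡n a b)) (≡-* νga νhb))
        (λ i i≤a+b i≢a → product-above-min (off-corner i i≤a+b i≢a))

    ·ₚ-minimalValuation : MinimalValuation (g ·ₚ h)
    ·ₚ-minimalValuation = record
      { min = E
      ; first = G.first + H.first
      ; last = G.last + H.last
      ; first≤last = ℕP.+-mono-≤ G.first≤last H.first≤last
      ; ν-first = ν-corner G.ν-first H.ν-first λ i i≤ i≢ →
          Sum.map (G.ν-<first i) (H.ν-<first _) (i<a⊎M∸i<b i≤ (inj₂ (refl , i≢)))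
      ; ν-last = ν-corner G.ν-last H.ν-last λ i _ i≢ →
          Sum.map (G.ν->last i) (H.ν->last _) (a<i⊎b<M∸i (inj₂ (refl , i≢)))
      ; ν-≥ = λ M → Convolution.convUpTo-all g h M (ν[_]≥ E) ≥-+ M
          (λ i _ → ≥-* (G.ν-≥ i) (H.ν-≥ (M ∸ i)))
      ; ν-<first = λ M M<first → Convolution.convUpTo-all g h M (ν[_]≥ ℤ.suc E) ≥-+ M
          (λ i i≤M → product-above-min (Sum.map (G.ν-<first i) (H.ν-<first _) (i<a⊎M∸i<b i≤M (inj₁ M<first))))
      ; ν->last = λ M last<M → Convolution.convUpTo-all g h M (ν[_]≥ ℤ.suc E) ≥-+ M
          (λ i _ → product-above-min (Sum.map (G.ν->last i) (H.ν->last _) (a<i⊎b<M∸i (inj₁ last<M))))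
      }

  record UnitOnlyAt (k l : ℕ) (F : ℕ → ℚ) : Set where
    field
      ν-unit  : ν[ F l ]≡ 0ℤ
      ν-other : ∀ j → j ≤ k → j ≢ l → ν[ F j ]≡ 1ℤ
      vanish  : ∀ j → k < j → F j ≡ 0ℚ

  module _ {k l : ℕ} {F : ℕ → ℚ} where

    UnitOnlyAt-cong : ∀ {G} → (∀ m → F m ≡ G m) → UnitOnlyAt k l F → UnitOnlyAt k l G
    UnitOnlyAt-cong F≡G U = record
      { ν-unit  = subst (ν[_]≡ 0ℤ) (F≡G l) ν-unit
      ; ν-other = λ j j≤k j≢l → subst (ν[_]≡ 1ℤ) (F≡G j) (ν-other j j≤k j≢l)
      ; vanish  = λ j k<j → trans (sym (F≡G j)) (vanish j k<j)
      }
      where open UnitOnlyAt U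

    UnitOnlyAt⇒hasDegree : l < k → UnitOnlyAt k l F → HasDegree k F
    UnitOnlyAt⇒hasDegree l<k U = proj₁ (ν-other k ℕP.≤-refl (ℕP.<⇒≢ l<k ∘ sym)) , vanish
      where open UnitOnlyAt U

    minimum-at-unit : UnitOnlyAt k l F → (M : MinimalValuation F) →
      let open MinimalValuation M in min ≡ 0ℤ × first ≡ l × last ≡ l
    minimum-at-unit U M = min≡0 , first≡l , index-of-min ν-last
      where
      open UnitOnlyAt U
      open MinimalValuation M
      min≤0 : min ℤ.≤ 0ℤ
      min≤0 = ≡∧≥⇒≤ ν-unit (ν-≥ l)
      index-of-min : ∀ {j} → ν[ F j ]≡ min → j ≡ l
      index-of-min {j} νFj≡min with ℕP.≤-<-connex j k
      ... | inj₂ k<j = contradiction (vanish j k<j) (proj₁ νFj≡min)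
      ... | inj₁ j≤k with j ℕP.≟ l
      ...   | yes j≡l = j≡l
      ...   | no  j≢l = contradiction (subst (ℤ._≤ 0ℤ) min≡1 min≤0) λ { (ℤ.+≤+ ()) }
        where
        min≡1 : min ≡ 1ℤ
        min≡1 = trans (sym (proj₂ νFj≡min)) (proj₂ (ν-other j j≤k j≢l))
      first≡l : first ≡ l
      first≡l = index-of-min ν-first
      min≡0 : min ≡ 0ℤ
      min≡0 = trans (sym (proj₂ ν-first)) (trans (cong (νℚ ∘ F) first≡l) (proj₂ ν-unit))

  module _ {g h : ℕ → ℚ} {d₁ d₂ : ℕ} (deg-g : HasDegree d₁ g) (deg-h : HasDegree d₂ h) where
    private
      MG = minimalValuation deg-g
      MH = minimalValuation deg-h
      module G = MinimalValuation MG
      module H = MinimalValuation MH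

    factor-degrees : ∀ {k l F} → 0 < l → l < k → UnitOnlyAt k l F → (∀ m → F m ≡ (g ·ₚ h) m) →
                     d₁ + d₂ ≡ k × (d₁ ≡ 0 ⊎ d₂ ≡ 0 ⊎ d₁ ≡ l ⊎ d₂ ≡ l)
    factor-degrees {k} {l} 0<l l<k U-F F≡gh = d₁+d₂≡k , degrees
      where
      U : UnitOnlyAt k l (g ·ₚ h)
      U = UnitOnlyAt-cong F≡gh U-F
      open UnitOnlyAt U

      minimum : G.min ℤ.+ H.min ≡ 0ℤ × G.first + H.first ≡ l × G.last + H.last ≡ l
      minimum = minimum-at-unit U (·ₚ-minimalValuation MG MH)

      min≡0 : G.min ℤ.+ H.min ≡ 0ℤ
      min≡0 = proj₁ minimum

      firsts≡l : G.first + H.first ≡ l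
      firsts≡l = proj₁ (proj₂ minimum)

      lasts≡l : G.last + H.last ≡ l
      lasts≡l = proj₂ (proj₂ minimum)

      d₁+d₂≡k : d₁ + d₂ ≡ k
      d₁+d₂≡k = hasDegree-unique (·ₚ-hasDegree deg-g deg-h) (UnitOnlyAt⇒hasDegree l<k U)

      first≡last : G.first ≡ G.last × H.first ≡ H.last
      first≡last = ≤-+-≡⇒≡ G.first≤last H.first≤last (trans firsts≡l (sym lasts≡l))

      two≡ : ℤ.suc G.min ℤ.+ ℤ.suc H.min ≡ ℤ.suc 1ℤ
      two≡ = trans (regroup G.min H.min) (cong (λ e → ℤ.suc (ℤ.suc e)) min≡0)
        where
        regroup : ∀ a b → (1ℤ ℤ.+ a) ℤ.+ (1ℤ ℤ.+ b) ≡ 1ℤ ℤ.+ (1ℤ ℤ.+ (a ℤ.+ b))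
        regroup = solve-∀

      at-minimum : ∀ {i j} → ν[ g i ℚ.* h j ]≡ 1ℤ → i ≡ G.first ⊎ j ≡ H.first
      at-minimum {i} {j} ν≡1 with i ℕP.≟ G.first | j ℕP.≟ H.first
      ... | yes i≡ | _      = inj₁ i≡
      ... | no _   | yes j≡ = inj₂ j≡
      ... | no i≢  | no j≢  = contradiction (subst (ν[ _ ]≥_) two≡ (≥-* νgi>min νhj>min)) (≡∧>⇒⊥ ν≡1)
        where
        νgi>min = off-minimum MG (proj₁ first≡last) i≢
        νhj>min = off-minimum MH (proj₂ first≡last) j≢

      bottom : 0 ≡ G.first ⊎ 0 ≡ H.first
      bottom = at-minimum (ν-other 0 z≤n (ℕP.<⇒≢ 0<l))

      top : d₁ ≡ G.first ⊎ d₂ ≡ H.first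
      top = at-minimum (subst (ν[_]≡ 1ℤ) (trans (cong (g ·ₚ h) (sym d₁+d₂≡k)) (·ₚ-leading deg-g deg-h))
                              (ν-other k ℕP.≤-refl (ℕP.<⇒≢ l<k ∘ sym)))

      degrees : d₁ ≡ 0 ⊎ d₂ ≡ 0 ⊎ d₁ ≡ l ⊎ d₂ ≡ l
      degrees with bottom | top
      ... | inj₁ 0≡Gfirst | inj₁ d₁≡Gfirst = inj₁ (trans d₁≡Gfirst (sym 0≡Gfirst))
      ... | inj₂ 0≡Hfirst | inj₂ d₂≡Hfirst = inj₂ (inj₁ (trans d₂≡Hfirst (sym 0≡Hfirst)))
      ... | inj₂ 0≡Hfirst | inj₁ d₁≡Gfirst = inj₂ (inj₂ (inj₁ (trans d₁≡Gfirst (begin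
        G.first         ≡⟨ ℕP.+-identityʳ G.first ⟨
        G.first + 0     ≡⟨ cong (λ j → G.first + j) 0≡Hfirst ⟩
        G.first + H.first ≡⟨ firsts≡l ⟩
        l               ∎))))
        where open ≡-Reasoning
      ... | inj₁ 0≡Gfirst | inj₂ d₂≡Hfirst = inj₂ (inj₂ (inj₂ (trans d₂≡Hfirst (begin
        H.first         ≡⟨⟩
        0 + H.first     ≡⟨ cong (_+ H.first) 0≡Gfirst ⟩
        G.first + H.first ≡⟨ firsts≡l ⟩
        l               ∎))))
        where open ≡-Reasoning

P′*[n∸k]!≡n! : ∀ n k → k ≤ n → (n P′ k) * (n ∸ k) ! ≡ n !
P′*[n∸k]!≡n! n zero    _   = ℕP.*-identityˡ (n !)
P′*[n∸k]!≡n! n (suc k) k<n = begin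
  (n ∸ k) * (n P′ k) * (n ∸ suc k) !   ≡⟨ cong (_* (n ∸ suc k) !) (ℕP.*-comm (n ∸ k) (n P′ k)) ⟩
  (n P′ k) * (n ∸ k) * (n ∸ suc k) !   ≡⟨ ℕP.*-assoc (n P′ k) (n ∸ k) _ ⟩
  (n P′ k) * ((n ∸ k) * (n ∸ suc k) !) ≡⟨ cong ((n P′ k) *_) ([n-k]*[n-k-1]!≡[n-k]! k<n) ⟩
  (n P′ k) * (n ∸ k) !                 ≡⟨ P′*[n∸k]!≡n! n k (ℕP.<⇒≤ k<n) ⟩
  n !                                ∎
  where open ≡-Reasoning

C*k!≡P′ : ∀ n k → k ≤ n → (n C k) * k ! ≡ n P′ k
C*k!≡P′ n k k≤n = ℕP.*-cancelʳ-≡ _ _ ((n ∸ k) !) {{(n ∸ k) ℕP.!≢0}} (begin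
  (n C k) * k ! * (n ∸ k) !                    ≡⟨ ℕP.*-assoc (n C k) (k !) _ ⟩
  (n C k) * (k ! * (n ∸ k) !)                  ≡⟨ ℕP.*-comm (n C k) _ ⟩
  k ! * (n ∸ k) ! * (n C k)                    ≡⟨ cong (k ! * (n ∸ k) ! *_) (nCk≡n!/k![n-k]! k≤n) ⟩
  k ! * (n ∸ k) ! * (n ! / (k ! * (n ∸ k) !)) ≡⟨ m*[n/m]≡n (k![n∸k]!∣n! k≤n) ⟩
  n !                                        ≡⟨ P′*[n∸k]!≡n! n k k≤n ⟨
  (n P′ k) * (n ∸ k) !                         ∎)
  where
  open ≡-Reasoning
  instance _ = k ℕP.!* (n ∸ k) !≢0

P′≢0 : ∀ {m s} → s ≤ m → m P′ s ≢ 0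
P′≢0 {m} {suc s} s<m eq with ℕP.m*n≡0⇒m≡0∨n≡0 (m ∸ s) eq
... | inj₁ m∸s≡0 = ℕP.m>n⇒m∸n≢0 s<m m∸s≡0
... | inj₂ P′≡0  = P′≢0 (ℕP.<⇒≤ s<m) P′≡0

C≢0 : ∀ {m s} → s ≤ m → m C s ≢ 0
C≢0 {m} {s} s≤m C≡0 = P′≢0 s≤m (trans (sym (C*k!≡P′ m s s≤m)) (cong (_* s !) C≡0))

module BinomialValuation (p : ℕ) (p-prime : Prime p) {n k l : ℕ} (k<p : k < p) (k<n : k < n)
       (l≤k : l ≤ k) (p∣n∸l : p ∣ n ∸ l) (p²∤n∸l : p ^ 2 ∤ n ∸ l) where

  open Valuation p p-prime

  p∤small : ∀ {m} → 0 < m → m ≤ k → p ∤ m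
  p∤small 0<m m≤k p∣m = ℕP.<⇒≱ k<p (ℕP.≤-trans (∣⇒≤ {{ℕ.>-nonZero 0<m}} p∣m) m≤k)

  p∤! : ∀ {m} → m ≤ k → p ∤ m !
  p∤! {zero}  _   = p∤1
  p∤! {suc m} m<k = p∤*-closed (p∤small (s≤s z≤n) m<k) (p∤! (ℕP.<⇒≤ m<k))

  ν-C≡ν-P′ : ∀ {m s} → s ≤ m → s ≤ k → ν (m C s) ≡ ν (m P′ s)
  ν-C≡ν-P′ {m} {s} s≤m s≤k = begin
    ν (m C s)             ≡⟨ ℕP.+-identityʳ _ ⟨
    ν (m C s) + 0         ≡⟨ cong (λ e → ν (m C s) + e) (ν≡0 (p∤! s≤k)) ⟨
    ν (m C s) + ν (s !)   ≡⟨ ν-* (C≢0 s≤m) (ℕ.≢-nonZero⁻¹ (s !) {{s ℕP.!≢0}}) ⟨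
    ν ((m C s) * s !)     ≡⟨ cong ν (C*k!≡P′ m s s≤m) ⟩
    ν (m P′ s)            ∎
    where open ≡-Reasoning

  private
    p∣-gap : ∀ {t u} → t ≤ u → u ≤ n → p ∣ n ∸ t → p ∣ n ∸ u → p ∣ u ∸ t
    p∣-gap {t} {u} t≤u u≤n p∣n∸t p∣n∸u = ∣m+n∣m⇒∣n (subst (p ∣_) (sym n∸t≡) p∣n∸t) p∣n∸u
      where
      n∸t≡ : (n ∸ u) + (u ∸ t) ≡ n ∸ t
      n∸t≡ = trans (sym (ℕP.+-∸-assoc (n ∸ u) t≤u)) (cong (_∸ t) (ℕP.m∸n+n≡m u≤n))

    ≤k⇒≤n : ∀ {t} → t ≤ k → t ≤ n
    ≤k⇒≤n t≤k = ℕP.<⇒≤ (ℕP.≤-<-trans t≤k k<n)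

  ν[n∸t]≡0 : ∀ {t} → t ≤ k → t ≢ l → ν (n ∸ t) ≡ 0
  ν[n∸t]≡0 {t} t≤k t≢l = ν≡0 p∤n∸t
    where
    p∤n∸t : p ∤ n ∸ t
    p∤n∸t p∣n∸t with ℕP.<-cmp t l
    ... | tri< t<l _ _ = p∤small (ℕP.m<n⇒0<n∸m t<l) (ℕP.≤-trans (ℕP.m∸n≤m l t) l≤k)
                           (p∣-gap (ℕP.<⇒≤ t<l) (≤k⇒≤n l≤k) p∣n∸t p∣n∸l)
    ... | tri≈ _ t≡l _ = t≢l t≡l
    ... | tri> _ _ l<t = p∤small (ℕP.m<n⇒0<n∸m l<t) (ℕP.≤-trans (ℕP.m∸n≤m t l) t≤k)
                           (p∣-gap (ℕP.<⇒≤ l<t) (≤k⇒≤n t≤k) p∣n∸l p∣n∸t)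

  ν-P′-step : ∀ o s → o + s ≤ k → ν ((n ∸ o) P′ suc s) ≡ ν (n ∸ (o + s)) + ν ((n ∸ o) P′ s)
  ν-P′-step o s o+s≤k =
    trans (ν-* n∸o∸s≢0 (P′≢0 s≤n∸o)) (cong (λ m → ν m + ν ((n ∸ o) P′ s)) (ℕP.∸-+-assoc n o s))
    where
    n∸o∸s≢0 : n ∸ o ∸ s ≢ 0
    n∸o∸s≢0 eq = ℕP.m>n⇒m∸n≢0 (ℕP.≤-<-trans o+s≤k k<n) (trans (sym (ℕP.∸-+-assoc n o s)) eq)
    s≤n∸o : s ≤ n ∸ o
    s≤n∸o = ℕP.m+n≤o⇒m≤o∸n s (subst (_≤ n) (ℕP.+-comm o s) (≤k⇒≤n o+s≤k))

  private
    o+s≤k : ∀ {o s} → o + suc s ≤ suc k → o + s ≤ k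
    o+s≤k {o} {s} le = ℕP.≤-pred (subst (_≤ suc k) (ℕP.+-suc o s) le)

    o+s≤1+k : ∀ {o s} → o + suc s ≤ suc k → o + s ≤ suc k
    o+s≤1+k le = ℕP.m≤n⇒m≤1+n (o+s≤k le)

  ν-P′-avoiding : ∀ o s → o + s ≤ suc k → l < o ⊎ o + s ≤ l → ν ((n ∸ o) P′ s) ≡ 0
  ν-P′-avoiding o zero    _  _ = ν≡0 p∤1
  ν-P′-avoiding o (suc s) le avoid = trans (ν-P′-step o s (o+s≤k le))
    (cong₂ _+_ (ν[n∸t]≡0 (o+s≤k le) o+s≢l) (ν-P′-avoiding o s (o+s≤1+k le) avoid′))
    where
    o+s<l : o + suc s ≤ l → o + s < l
    o+s<l = subst (_≤ l) (ℕP.+-suc o s)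
    o+s≢l : o + s ≢ l
    o+s≢l eq = [ (λ l<o → ℕP.<⇒≱ l<o (subst (o ≤_) eq (ℕP.m≤m+n o s)))
               , (λ le′ → ℕP.<⇒≢ (o+s<l le′) eq) ]′ avoid
    avoid′ : l < o ⊎ o + s ≤ l
    avoid′ = Sum.map₂ (ℕP.<⇒≤ ∘ o+s<l) avoid

  ν-P′-through : ∀ o s → o + s ≤ suc k → o ≤ l → l < o + s → ν ((n ∸ o) P′ s) ≡ 1
  ν-P′-through o zero    _  o≤l l<o+0 = contradiction o≤l (ℕP.<⇒≱ (subst (l <_) (ℕP.+-identityʳ o) l<o+0))
  ν-P′-through o (suc s) le o≤l l<o+1+s with l ℕP.≟ o + s
  ... | yes l≡o+s = trans (ν-P′-step o s (o+s≤k le))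
    (cong₂ _+_ (trans (cong (λ t → ν (n ∸ t)) (sym l≡o+s)) (ν≡1 p∣n∸l p²∤n∸l))
               (ν-P′-avoiding o s (o+s≤1+k le) (inj₂ (ℕP.≤-reflexive (sym l≡o+s)))))
  ... | no  l≢o+s = trans (ν-P′-step o s (o+s≤k le))
    (cong₂ _+_ (ν[n∸t]≡0 (o+s≤k le) (l≢o+s ∘ sym))
               (ν-P′-through o s (o+s≤1+k le) o≤l
                 (ℕP.≤∧≢⇒< (ℕP.≤-pred (subst (l <_) (ℕP.+-suc o s) l<o+1+s)) l≢o+s)))

  private
    n∸j∸1≡n∸[1+j] : ∀ j → n ∸ j ∸ 1 ≡ n ∸ suc j
    n∸j∸1≡n∸[1+j] j = trans (ℕP.∸-+-assoc n j 1) (cong (n ∸_) (ℕP.+-comm j 1))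

    k∸j≤n∸j∸1 : ∀ j → k ∸ j ≤ n ∸ j ∸ 1
    k∸j≤n∸j∸1 j = subst (k ∸ j ≤_) (sym (n∸j∸1≡n∸[1+j] j)) (ℕP.∸-monoˡ-≤ (suc j) k<n)

    1+j+[k∸j]≡1+k : ∀ {j} → j ≤ k → suc j + (k ∸ j) ≡ suc k
    1+j+[k∸j]≡1+k j≤k = cong suc (ℕP.m+[n∸m]≡n j≤k)

    ν-C[k∸j]≡ν-P′ : ∀ {j} → j ≤ k → ν ((n ∸ j ∸ 1) C (k ∸ j)) ≡ ν ((n ∸ suc j) P′ (k ∸ j))
    ν-C[k∸j]≡ν-P′ {j} j≤k = trans (ν-C≡ν-P′ (k∸j≤n∸j∸1 j) (ℕP.m∸n≤m k j))
                                  (cong (λ m → ν (m P′ (k ∸ j))) (n∸j∸1≡n∸[1+j] j))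

  ν-nCj≡0 : ∀ {j} → j ≤ k → j ≤ l → ν (n C j) ≡ 0
  ν-nCj≡0 {j} j≤k j≤l = trans (ν-C≡ν-P′ (≤k⇒≤n j≤k) j≤k) (ν-P′-avoiding 0 j (ℕP.m≤n⇒m≤1+n j≤k) (inj₂ j≤l))

  ν-nCj≡1 : ∀ {j} → j ≤ k → l < j → ν (n C j) ≡ 1
  ν-nCj≡1 {j} j≤k l<j = trans (ν-C≡ν-P′ (≤k⇒≤n j≤k) j≤k) (ν-P′-through 0 j (ℕP.m≤n⇒m≤1+n j≤k) z≤n l<j)

  ν-C[k∸j]≡1 : ∀ {j} → j ≤ k → j < l → ν ((n ∸ j ∸ 1) C (k ∸ j)) ≡ 1
  ν-C[k∸j]≡1 {j} j≤k j<l = trans (ν-C[k∸j]≡ν-P′ j≤k) (ν-P′-through (suc j) (k ∸ j)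
    (ℕP.≤-reflexive (1+j+[k∸j]≡1+k j≤k)) j<l (subst (l <_) (sym (1+j+[k∸j]≡1+k j≤k)) (s≤s l≤k)))

  ν-C[k∸j]≡0 : ∀ {j} → j ≤ k → l ≤ j → ν ((n ∸ j ∸ 1) C (k ∸ j)) ≡ 0
  ν-C[k∸j]≡0 {j} j≤k l≤j = trans (ν-C[k∸j]≡ν-P′ j≤k) (ν-P′-avoiding (suc j) (k ∸ j)
    (ℕP.≤-reflexive (1+j+[k∸j]≡1+k j≤k)) (inj₁ (s≤s l≤j)))

  private
    ∣-1^m∣≡1 : ∀ m → ∣ -[1+ 0 ] ℤ.^ m ∣ ≡ 1
    ∣-1^m∣≡1 zero    = refl
    ∣-1^m∣≡1 (suc m) = trans (ℤP.abs-* -[1+ 0 ] (-[1+ 0 ] ℤ.^ m)) (trans (ℕP.*-identityˡ _) (∣-1^m∣≡1 m))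

  ∣c∣≡ : ∀ j → ∣ c n k j ∣ ≡ (n C j) * ((n ∸ j ∸ 1) C (k ∸ j))
  ∣c∣≡ j = trans (ℤP.abs-* (-[1+ 0 ] ℤ.^ (k ∸ j)) (+ N))
                 (trans (cong (_* N) (∣-1^m∣≡1 (k ∸ j))) (ℕP.*-identityˡ N))
    where N = (n C j) * ((n ∸ j ∸ 1) C (k ∸ j))

  ν∣c∣≡ν+ν : ∀ {j} → j ≤ k → ν ∣ c n k j ∣ ≡ ν (n C j) + ν ((n ∸ j ∸ 1) C (k ∸ j))
  ν∣c∣≡ν+ν {j} j≤k = trans (cong ν (∣c∣≡ j)) (ν-* (C≢0 (≤k⇒≤n j≤k)) (C≢0 (k∸j≤n∸j∸1 j)))

  c≢0 : ∀ {j} → j ≤ k → c n k j ≢ 0ℤ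
  c≢0 {j} j≤k c≡0 = [ C≢0 (≤k⇒≤n j≤k) , C≢0 (k∸j≤n∸j∸1 j) ]′
    (ℕP.m*n≡0⇒m≡0∨n≡0 (n C j) (trans (sym (∣c∣≡ j)) (cong ∣_∣ c≡0)))

  ν∣c∣≡1 : ∀ {j} → j ≤ k → j ≢ l → ν ∣ c n k j ∣ ≡ 1
  ν∣c∣≡1 {j} j≤k j≢l with ℕP.<-cmp j l
  ... | tri< j<l _ _ = trans (ν∣c∣≡ν+ν j≤k) (cong₂ _+_ (ν-nCj≡0 j≤k (ℕP.<⇒≤ j<l)) (ν-C[k∸j]≡1 j≤k j<l))
  ... | tri≈ _ j≡l _ = contradiction j≡l j≢l
  ... | tri> _ _ l<j = trans (ν∣c∣≡ν+ν j≤k) (cong₂ _+_ (ν-nCj≡1 j≤k l<j) (ν-C[k∸j]≡0 j≤k (ℕP.<⇒≤ l<j)))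

  ν∣c∣≡0 : ν ∣ c n k l ∣ ≡ 0
  ν∣c∣≡0 = trans (ν∣c∣≡ν+ν l≤k) (cong₂ _+_ (ν-nCj≡0 l≤k ℕP.≤-refl) (ν-C[k∸j]≡0 l≤k ℕP.≤-refl))

  open NewtonPolygon p p-prime using (UnitOnlyAt)

  module _ (a : ℕ → ℤ) (a≢0 : ∀ j → j ≤ k → a j ≢ 0ℤ) (p∤a : ∀ j → j ≤ k → p ∤ ∣ a j ∣) where

    private
      F≡ : ∀ {j} → j ≤ k → F n k a j ≡ (a j ℤ.* c n k j) ℚ./ 1
      F≡ {j} j≤k with j ℕ.≤? k
      ... | yes _   = refl
      ... | no  j≰k = contradiction j≤k j≰k

      F-vanish : ∀ j → k < j → F n k a j ≡ 0ℚ
      F-vanish j k<j with j ℕ.≤? k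
      ... | yes j≤k = contradiction j≤k (ℕP.<⇒≱ k<j)
      ... | no  _   = refl

      ν-F : ∀ {j} → j ≤ k → ν[ F n k a j ]≡ + ν ∣ c n k j ∣
      ν-F {j} j≤k = subst₂ ν[_]≡_ (sym (F≡ j≤k)) (cong +_ νℤ[a*c]≡)
                           (νℚ-integer (*-≢0ℤ (a≢0 j j≤k) (c≢0 j≤k)))
        where
        νℤ[a*c]≡ : νℤ (a j ℤ.* c n k j) ≡ ν ∣ c n k j ∣
        νℤ[a*c]≡ = trans (νℤ-* (a≢0 j j≤k) (c≢0 j≤k)) (cong (_+ ν ∣ c n k j ∣) (ν≡0 (p∤a j j≤k)))

    F-unitOnlyAt : UnitOnlyAt k l (F n k a)
    F-unitOnlyAt = record
      { ν-unit  = subst (λ e → ν[ F n k a l ]≡ + e) ν∣c∣≡0 (ν-F l≤k)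
      ; ν-other = λ j j≤k j≢l → subst (λ e → ν[ F n k a j ]≡ + e) (ν∣c∣≡1 j≤k j≢l) (ν-F j≤k)
      ; vanish  = F-vanish
      }

one-factor-constant : ∀ {k l′ l″ d₁ d₂} → l′ < l″ → l′ + l″ ≢ k → d₁ + d₂ ≡ k →
  d₁ ≡ 0 ⊎ d₂ ≡ 0 ⊎ d₁ ≡ l′ ⊎ d₂ ≡ l′ → d₁ ≡ 0 ⊎ d₂ ≡ 0 ⊎ d₁ ≡ l″ ⊎ d₂ ≡ l″ → d₁ ≡ 0 ⊎ d₂ ≡ 0
one-factor-constant _ _ _ (inj₁ d₁≡0)        _                  = inj₁ d₁≡0
one-factor-constant _ _ _ (inj₂ (inj₁ d₂≡0)) _                  = inj₂ d₂≡0
one-factor-constant _ _ _ _                  (inj₁ d₁≡0)        = inj₁ d₁≡0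
one-factor-constant _ _ _ _                  (inj₂ (inj₁ d₂≡0)) = inj₂ d₂≡0
one-factor-constant l′<l″ _ _ (inj₂ (inj₂ (inj₁ refl))) (inj₂ (inj₂ (inj₁ l′≡l″))) =
  contradiction l′≡l″ (ℕP.<⇒≢ l′<l″)
one-factor-constant _ l′+l″≢k d₁+d₂≡k (inj₂ (inj₂ (inj₁ refl))) (inj₂ (inj₂ (inj₂ refl))) =
  contradiction d₁+d₂≡k l′+l″≢k
one-factor-constant {l′ = l′} {l″} _ l′+l″≢k d₁+d₂≡k (inj₂ (inj₂ (inj₂ refl))) (inj₂ (inj₂ (inj₁ refl))) =
  contradiction (trans (ℕP.+-comm l′ l″) d₁+d₂≡k) l′+l″≢k
one-factor-constant l′<l″ _ _ (inj₂ (inj₂ (inj₂ refl))) (inj₂ (inj₂ (inj₂ l′≡l″))) =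
  contradiction l′≡l″ (ℕP.<⇒≢ l′<l″)

corollary2p3 : (n k : ℕ) → 1 ≤ n → 1 ≤ k → k + 2 ≤ n →
    (a : ℕ → ℤ) →
    (∀ j → j ≤ k → a j ≢ ℤ.0ℤ) →
    (∀ j → j ≤ k → ∀ p → Prime p → p ∣ (∣ a j ∣) → p ≤ k) →
    (Σ ℕ λ l′ → Σ ℕ λ l″ → Σ ℕ λ p′ → Σ ℕ λ p″ →
       (1 ≤ l′) × (l′ < l″) × (l″ < k) × (l′ + l″ ≢ k) ×
       Prime p′ × Prime p″ × (k < p′) × (k < p″) ×
       (p′ ∣ n ∸ l′) × ¬ (p′ ^ 2 ∣ n ∸ l′) ×
       (p″ ∣ n ∸ l″) × ¬ (p″ ^ 2 ∣ n ∸ l″)) →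
    IrreducibleOverℚ (F n k a)
corollary2p3 n k _ 1≤k k+2≤n a a≢0 a-smooth
  (l′ , l″ , p′ , p″ , 0<l′ , l′<l″ , l″<k , l′+l″≢k , p′-prime , p″-prime , k<p′ , k<p″ ,
   p′∣n∸l′ , p′²∤n∸l′ , p″∣n∸l″ , p″²∤n∸l″) =
  (k , 1≤k , NewtonPolygon.UnitOnlyAt⇒hasDegree p′ p′-prime l′<k unit′) ,
  λ g h d₁ d₂ deg-g deg-h F≡gh →
    let degrees′ = NewtonPolygon.factor-degrees p′ p′-prime deg-g deg-h 0<l′ l′<k unit′ F≡gh
        degrees″ = NewtonPolygon.factor-degrees p″ p″-prime deg-g deg-h 0<l″ l″<k unit″ F≡gh
    in one-factor-constant l′<l″ l′+l″≢k (proj₁ degrees′) (proj₂ degrees′) (proj₂ degrees″)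
  where
  k<n : k < n
  k<n = ℕP.<-≤-trans (ℕP.m<m+n k (s≤s z≤n)) k+2≤n
  l′<k : l′ < k
  l′<k = ℕP.<-trans l′<l″ l″<k
  0<l″ : 0 < l″
  0<l″ = ℕP.<-trans 0<l′ l′<l″
  q∤a : ∀ {q} → Prime q → k < q → ∀ j → j ≤ k → q ∤ ∣ a j ∣
  q∤a q-prime k<q j j≤k q∣aj = ℕP.<⇒≱ k<q (a-smooth j j≤k _ q-prime q∣aj)
  unit′ : NewtonPolygon.UnitOnlyAt p′ p′-prime k l′ (F n k a)
  unit′ = BinomialValuation.F-unitOnlyAt p′ p′-prime k<p′ k<n (ℕP.<⇒≤ l′<k) p′∣n∸l′ p′²∤n∸l′
            a a≢0 (q∤a p′-prime k<p′)
  unit″ : NewtonPolygon.UnitOnlyAt p″ p″-prime k l″ (F n k a)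
  unit″ = BinomialValuation.F-unitOnlyAt p″ p″-prime k<p″ k<n (ℕP.<⇒≤ l″<k) p″∣n∸l″ p″²∤n∸l″
            a a≢0 (q∤a p″-prime k<p″)
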